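{- Let $n\ge1$, $A\in\mathrm{Int}(n)$ and $x=\Gamma(A)=(x_1,\dots,x_n)$. Then the trace of $A$ equals $|\{i\in[n]:x_i=\mathrm{asc}_i(x)\}|$.
   Context: $\mathrm{Int}(n)$ is the set of upper triangular square matrices with non-negative integer entries summing to $n$ such that every row and column has a non-zero entry. For such $A$: $\dim(A)$ is the number of rows, $\mathrm{index}(A)$ the smallest $i$ with $A_{i,\dim(A)}>0$, $\mathrm{val}(A)=A_{\mathrm{index}(A),\dim(A)}$. For a sequence $y$, $\mathrm{asc}(y)$ is the number of $i$ with $y_i<y_{i+1}$, and $\mathrm{asc}_k(y)=\mathrm{asc}(y_1,\dots,y_k)$. $\mathrm{Asc}(n)$ is the set of integer sequences $(x_1,\dots,x_n)$ with $x_1=0$ and $x_i\in[0,1+\mathrm{asc}(x_1,\dots,x_{i-1})]$ for $1<i\le n$. Removal operation $f$ on $A\in\mathrm{Int}(n)$, $n\ge2$: (Rem1) if $\mathrm{val}(A)>1$, or if $\mathrm{val}(A)=1$, $\mathrm{index}(A)<\dim(A)$ and row $\mathrm{index}(A)$ has another positive entry, decrease entry $(\mathrm{index}(A),\dim(A))$ by $1$; (Rem2) if $\mathrm{val}(A)=1$ and $\mathrm{index}(A)=\dim(A)$, delete last row and column; (Rem3) if $\mathrm{val}(A)=1$, $\mathrm{index}(A)<\dim(A)$ and all other entries of row $\mathrm{index}(A)$ are $0$, set $A_{i,\dim(A)}:=A_{i,\mathrm{index}(A)}$ for $1\le i\le\mathrm{index}(A)-1$, then delete row and column $\mathrm{index}(A)$.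 $\Gamma:\mathrm{Int}(n)\to\mathrm{Asc}(n)$ (a bijection): $\Gamma((1))=(0)$ and for $n\ge2$, $\Gamma(A)$ is $\Gamma(f(A))$ with $\mathrm{index}(A)-1$ appended. -}

module Defs where

open import Data.Bool using (Bool; true; false; if_then_else_; _∧_; _∨_; not)
open import Data.Nat using (ℕ; zero; suc; _+_; _∸_; _<_; _≤ᵇ_; _<ᵇ_; _≡ᵇ_)
open import Data.Nat.Properties using (_≟_)
open import Data.Fin using (Fin; toℕ; fromℕ; inject₁; punchIn) renaming (zero to fzero; suc to fsuc)
import Data.Fin.Properties as FinP
open import Data.Maybe using (Maybe; just; nothing)
open import Data.List using (List; []; _∷_; take)
open import Data.Vec using (Vec; []; _∷ʳ_; lookup; toList)
open import Data.Product using (_×_; ∃-syntax)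
open import Relation.Nullary.Decidable using (isYes)
open import Relation.Binary.PropositionalEquality using (_≡_)

-- Square matrices of natural numbers, as functions on Fin indices
-- (indices are 0-based: entry (i,j) of the paper is ent (i-1) (j-1)).
record Mat : Set where
  constructor mat
  field
    dim : ℕ
    ent : Fin dim → Fin dim → ℕ
open Mat public

∑ : ∀ {d} → (Fin d → ℕ) → ℕ
∑ {zero}  g = 0
∑ {suc d} g = g fzero + ∑ (λ i → g (fsuc i))

anyF : ∀ {d} → (Fin d → Bool) → Bool
anyF {zero}  g = false
anyF {suc d} g = g fzero ∨ anyF (λ i → g (fsuc i))

entrySum : Mat → ℕ
entrySum A = ∑ (λ i → ∑ (λ j → ent A i j))

trace : Mat → ℕ
trace A = ∑ (λ i → ent A i i)

record IsInt (n : ℕ) (A : Mat) : Set where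
  field
    upper   : ∀ i j → toℕ j < toℕ i → ent A i j ≡ 0
    sumIs   : entrySum A ≡ n
    rowsNZ  : ∀ i → ∃[ j ] 0 < ent A i j
    colsNZ  : ∀ j → ∃[ i ] 0 < ent A i j

firstPos : ∀ {d} → (Fin d → ℕ) → Maybe (Fin d)
firstPos {zero}  g = nothing
firstPos {suc d} g with g fzero
... | zero  = Data.Maybe.map fsuc (firstPos (λ i → g (fsuc i)))
  where import Data.Maybe
... | suc _ = just fzero

-- index(A) - 1 (0-based row index), for a matrix of dimension suc m.
-- (Default to the last row if the last column is zero; never happens on Int(n).)
index0 : ∀ {m} → (Fin (suc m) → Fin (suc m) → ℕ) → Fin (suc m)
index0 {m} a with firstPos (λ i → a i (fromℕ m))
... | just i  = i
... | nothing = fromℕ m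

f : Mat → Mat
f (mat zero a) = mat zero a
f (mat (suc m) a) =
  if (2 ≤ᵇ v) ∨ (not isLast ∧ other) then mat (suc m) decr
  else if isLast then mat m rem2
  else mat m rem3
  where
    last : Fin (suc m)
    last = fromℕ m
    idx : Fin (suc m)
    idx = index0 a
    v : ℕ
    v = a idx last
    isLast : Bool
    isLast = toℕ idx ≡ᵇ m
    other : Bool
    other = anyF (λ j → not (isYes (j FinP.≟ last)) ∧ (1 ≤ᵇ a idx j))
    decr : Fin (suc m) → Fin (suc m) → ℕ
    decr i j = if isYes (i FinP.≟ idx) ∧ isYes (j FinP.≟ last) then a i j ∸ 1 else a i j
    rem2 : Fin m → Fin m → ℕ
    rem2 i j = a (inject₁ i) (inject₁ j)
    b : Fin (suc m) → Fin (suc m) → ℕ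
    b i j = if isYes (j FinP.≟ last) ∧ (toℕ i <ᵇ toℕ idx) then a i idx else a i j
    rem3 : Fin m → Fin m → ℕ
    rem3 i j = b (punchIn idx i) (punchIn idx j)

Γ : (n : ℕ) → Mat → Vec ℕ n
Γ zero          A = []
Γ (suc zero)    A = 0 ∷ []
  where open Data.Vec using (_∷_)
Γ (suc (suc k)) A = Γ (suc k) (f A) ∷ʳ idx A
  where
    idx : Mat → ℕ
    idx (mat zero a)    = 0
    idx (mat (suc m) a) = toℕ (index0 a)

asc : List ℕ → ℕ
asc (a ∷ b ∷ rest) = (if a <ᵇ b then 1 else 0) + asc (b ∷ rest)
asc _ = 0

-- |{ i ∈ [n] : x_i = asc_i(x) }|   (i 0-based here: x_{i+1} = lookup x i)
fixedCount : ∀ {n} → Vec ℕ n → ℕ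
fixedCount {n} x =
  ∑ (λ (i : Fin n) → if isYes (lookup x i ≟ asc (take (suc (toℕ i)) (toList x))) then 1 else 0)

-- Write B = f(A), so that Γ(A) is Γ(B) followed by index(A) − 1.  Along this recursion one
-- carries two invariants: the last entry of Γ(A) is index(A) − 1, and asc(Γ(A)) = dim(A) − 1.
-- Given the latter, the appended entry is a fixed point exactly when index(A) = dim(A), and
-- exactly then f lowers the trace by one: Rem1 decrements the corner (dim, dim), Rem2 deletes
-- a diagonal 1, and Rem3 deletes a row index(A) whose only positive entry is in the last column.
-- The ascent invariant holds because the dimension drops exactly when the appended entry is an
-- ascent: under Rem1 the first positive entry of the last column cannot move up, under Rem2
-- index(B) ≤ dim(B) < dim(A), and under Rem3 the empty diagonal entry (index(A), index(A)) forces
-- a positive entry higher up in column index(A), which is copied into the new last column.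

module Submission where

open import Defs
open import Data.Bool using (Bool; true; false; if_then_else_; _∧_; not; T)
open import Data.Bool.Properties using (T-∧)
open import Data.Empty using (⊥-elim)
open import Data.Fin using (Fin; toℕ; fromℕ; inject₁; punchIn; punchOut) renaming (zero to fzero; suc to fsuc)
import Data.Fin.Properties as FinP
open import Data.List using (List; _∷_; take)
open import Data.Maybe using (just; nothing)
open import Data.Nat using (ℕ; zero; suc; _+_; _∸_; _≤_; _<_; _≤ᵇ_; _<ᵇ_; _≡ᵇ_; z≤n; s≤s; s≤s⁻¹)
open import Data.Nat.Properties
open import Algebra.Properties.CommutativeMonoid.Sum +-0-commutativeMonoid using (sum; sum-remove; sum-init-last)
open import Data.Product using (_×_; _,_; proj₁; proj₂; ∃-syntax)
open import Data.Sum using (_⊎_; inj₁; inj₂)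
open import Data.Vec using (Vec; []; _∷_; _∷ʳ_; lookup; toList)
import Data.Vec as Vec
open import Data.Vec.Properties using (last-∷ʳ)
open import Data.Vec.Functional using (removeAt)
open import Function using (_∘_; _⇔_; mk⇔; Equivalence)
open import Relation.Binary.PropositionalEquality
open import Relation.Nullary using (Dec; yes; no; ¬_; Reflects; ofʸ; ofⁿ; proof)
open import Relation.Nullary.Decidable using (isYes; isYes≗does; dec-true; dec-false; toWitnessFalse; fromWitnessFalse)

open ≡-Reasoning

Square : ℕ → Set
Square d = Fin d → Fin d → ℕ

indicator : Bool → ℕ
indicator b = if b then 1 else 0

isYes-true : ∀ {p} {P : Set p} (P? : Dec P) → P → isYes P? ≡ true
isYes-true P? p = trans (isYes≗does P?) (dec-true P? p)

isYes-false : ∀ {p} {P : Set p} (P? : Dec P) → ¬ P → isYes P? ≡ false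
isYes-false P? ¬p = trans (isYes≗does P?) (dec-false P? ¬p)

-- Finite sums

∑≡sum : ∀ {d} (g : Fin d → ℕ) → ∑ g ≡ sum g
∑≡sum {zero}  g = refl
∑≡sum {suc d} g = cong (g fzero +_) (∑≡sum (g ∘ fsuc))

∑-cong : ∀ {d} {g h : Fin d → ℕ} → (∀ i → g i ≡ h i) → ∑ g ≡ ∑ h
∑-cong {zero}  g≗h = refl
∑-cong {suc d} g≗h = cong₂ _+_ (g≗h fzero) (∑-cong (g≗h ∘ fsuc))

∑-zero : ∀ d → ∑ {d} (λ _ → 0) ≡ 0
∑-zero zero    = refl
∑-zero (suc d) = ∑-zero d

∑-removeAt : ∀ {d} (p : Fin (suc d)) (g : Fin (suc d) → ℕ) → ∑ g ≡ g p + ∑ (removeAt g p)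
∑-removeAt p g = begin
  ∑ g                      ≡⟨ ∑≡sum g ⟩
  sum g                    ≡⟨ sum-remove {i = p} g ⟩
  g p + sum (removeAt g p) ≡⟨ cong (g p +_) (∑≡sum (removeAt g p)) ⟨
  g p + ∑ (removeAt g p)   ∎

∑-init-last : ∀ {d} (g : Fin (suc d) → ℕ) → ∑ g ≡ ∑ (g ∘ inject₁) + g (fromℕ d)
∑-init-last {d} g = begin
  ∑ g                              ≡⟨ ∑≡sum g ⟩
  sum g                            ≡⟨ sum-init-last g ⟩
  sum (g ∘ inject₁) + g (fromℕ d)  ≡⟨ cong (_+ g (fromℕ d)) (∑≡sum (g ∘ inject₁)) ⟨
  ∑ (g ∘ inject₁) + g (fromℕ d)    ∎

∑-add-at : ∀ {d} (p : Fin d) {g h : Fin d → ℕ} {c} →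
           (∀ i → i ≢ p → g i ≡ h i) → g p ≡ c + h p → ∑ g ≡ c + ∑ h
∑-add-at {suc d} p {g} {h} {c} same at-p = begin
  ∑ g                          ≡⟨ ∑-removeAt p g ⟩
  g p + ∑ (removeAt g p)       ≡⟨ cong₂ _+_ at-p (∑-cong (λ i → same (punchIn p i) (FinP.punchInᵢ≢i p i))) ⟩
  c + h p + ∑ (removeAt h p)   ≡⟨ +-assoc c (h p) _ ⟩
  c + (h p + ∑ (removeAt h p)) ≡⟨ cong (c +_) (∑-removeAt p h) ⟨
  c + ∑ h                      ∎

∑-single : ∀ {d} (p : Fin (suc d)) (g : Fin (suc d) → ℕ) → (∀ i → i ≢ p → g i ≡ 0) → ∑ g ≡ g p
∑-single {d} p g zero-off = begin
  ∑ g                      ≡⟨ ∑-add-at p {h = λ _ → 0} zero-off (sym (+-identityʳ (g p))) ⟩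
  g p + ∑ {suc d} (λ _ → 0) ≡⟨ cong (g p +_) (∑-zero (suc d)) ⟩
  g p + 0                  ≡⟨ +-identityʳ (g p) ⟩
  g p                      ∎

term≤∑ : ∀ {d} (p : Fin d) (g : Fin d → ℕ) → g p ≤ ∑ g
term≤∑ {suc d} p g = subst (g p ≤_) (sym (∑-removeAt p g)) (m≤m+n (g p) _)

card≤∑ : ∀ {d} (g : Fin d → ℕ) → (∀ i → 0 < g i) → d ≤ ∑ g
card≤∑ {zero}  g pos = z≤n
card≤∑ {suc d} g pos = +-mono-≤ (pos fzero) (card≤∑ (g ∘ fsuc) (pos ∘ fsuc))

-- Ascents and fixed points of sequences

lookup-∷ʳ-inject₁ : ∀ {d} (xs : Vec ℕ d) x (i : Fin d) → lookup (xs ∷ʳ x) (inject₁ i) ≡ lookup xs i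
lookup-∷ʳ-inject₁ (y ∷ xs) x fzero    = refl
lookup-∷ʳ-inject₁ (y ∷ xs) x (fsuc i) = lookup-∷ʳ-inject₁ xs x i

lookup-∷ʳ-fromℕ : ∀ {d} (xs : Vec ℕ d) x → lookup (xs ∷ʳ x) (fromℕ d) ≡ x
lookup-∷ʳ-fromℕ []       x = refl
lookup-∷ʳ-fromℕ (y ∷ xs) x = lookup-∷ʳ-fromℕ xs x

take-∷ʳ-inject₁ : ∀ {d} (xs : Vec ℕ d) x (i : Fin d) →
                  take (suc (toℕ (inject₁ i))) (toList (xs ∷ʳ x)) ≡ take (suc (toℕ i)) (toList xs)
take-∷ʳ-inject₁ (y ∷ xs) x fzero    = refl
take-∷ʳ-inject₁ (y ∷ xs) x (fsuc i) = cong (y ∷_) (take-∷ʳ-inject₁ xs x i)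

take-∷ʳ-fromℕ : ∀ {d} (xs : Vec ℕ d) x → take (suc (toℕ (fromℕ d))) (toList (xs ∷ʳ x)) ≡ toList (xs ∷ʳ x)
take-∷ʳ-fromℕ []       x = refl
take-∷ʳ-fromℕ (y ∷ xs) x = cong (y ∷_) (take-∷ʳ-fromℕ xs x)

fixedCount-∷ʳ : ∀ {d} (xs : Vec ℕ d) x →
                fixedCount (xs ∷ʳ x) ≡ fixedCount xs + indicator (isYes (x ≟ asc (toList (xs ∷ʳ x))))
fixedCount-∷ʳ {d} xs x = trans (∑-init-last fixedAt) (cong₂ _+_
  (∑-cong (λ i → cong₂ isFixed (lookup-∷ʳ-inject₁ xs x i) (take-∷ʳ-inject₁ xs x i)))
  (cong₂ isFixed (lookup-∷ʳ-fromℕ xs x) (take-∷ʳ-fromℕ xs x)))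
  where
    isFixed : ℕ → List ℕ → ℕ
    isFixed y ys = indicator (isYes (y ≟ asc ys))
    fixedAt : Fin (suc d) → ℕ
    fixedAt i = isFixed (lookup (xs ∷ʳ x) i) (take (suc (toℕ i)) (toList (xs ∷ʳ x)))

asc-∷ʳ : ∀ {d} (xs : Vec ℕ (suc d)) x →
         asc (toList (xs ∷ʳ x)) ≡ asc (toList xs) + indicator (Vec.last xs <ᵇ x)
asc-∷ʳ (y ∷ [])     x = +-comm (indicator (y <ᵇ x)) 0
asc-∷ʳ (y ∷ z ∷ xs) x = begin
  indicator (y <ᵇ z) + asc (toList ((z ∷ xs) ∷ʳ x))
    ≡⟨ cong (indicator (y <ᵇ z) +_) (asc-∷ʳ (z ∷ xs) x) ⟩
  indicator (y <ᵇ z) + (asc (toList (z ∷ xs)) + indicator (Vec.last (z ∷ xs) <ᵇ x))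
    ≡⟨ +-assoc (indicator (y <ᵇ z)) _ _ ⟨
  indicator (y <ᵇ z) + asc (toList (z ∷ xs)) + indicator (Vec.last (z ∷ xs) <ᵇ x) ∎

firstPos-just : ∀ {d} (g : Fin d → ℕ) {i} → firstPos g ≡ just i →
                0 < g i × (∀ j → toℕ j < toℕ i → g j ≡ 0)
firstPos-just {suc d} g eq with g fzero in g0
firstPos-just {suc d} g refl | suc _ = subst (0 <_) (sym g0) (s≤s z≤n) , λ j ()
firstPos-just {suc d} g eq   | zero with firstPos (g ∘ fsuc) in rest
firstPos-just {suc d} g refl | zero | just i =
  pos , λ { fzero _ → g0 ; (fsuc j) (s≤s j<i) → below j j<i }
  where
    pos : 0 < g (fsuc i)
    pos = proj₁ (firstPos-just (g ∘ fsuc) rest)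
    below : ∀ j → toℕ j < toℕ i → g (fsuc j) ≡ 0
    below = proj₂ (firstPos-just (g ∘ fsuc) rest)

firstPos-nothing : ∀ {d} (g : Fin d → ℕ) → firstPos g ≡ nothing → ∀ j → g j ≡ 0
firstPos-nothing {suc d} g eq j with g fzero in g0
firstPos-nothing {suc d} g () j        | suc _
firstPos-nothing {suc d} g eq j        | zero with firstPos (g ∘ fsuc) in rest
firstPos-nothing {suc d} g () j        | zero | just _
firstPos-nothing {suc d} g eq fzero    | zero | nothing = g0
firstPos-nothing {suc d} g eq (fsuc j) | zero | nothing = firstPos-nothing (g ∘ fsuc) rest j

module _ {m} (a : Square (suc m)) where

  index0-minimal : ∀ r → toℕ r < toℕ (index0 a) → a r (fromℕ m) ≡ 0
  index0-minimal r r<i with firstPos (λ i → a i (fromℕ m)) in eq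
  ... | just i  = proj₂ (firstPos-just (λ i → a i (fromℕ m)) eq) r r<i
  ... | nothing = firstPos-nothing (λ i → a i (fromℕ m)) eq r

  index0-positive : ∀ r → 0 < a r (fromℕ m) → 0 < a (index0 a) (fromℕ m)
  index0-positive r pos with firstPos (λ i → a i (fromℕ m)) in eq
  ... | just i  = proj₁ (firstPos-just (λ i → a i (fromℕ m)) eq)
  ... | nothing = ⊥-elim (<⇒≢ pos (sym (firstPos-nothing (λ i → a i (fromℕ m)) eq r)))

  index0-≤ : ∀ r → 0 < a r (fromℕ m) → toℕ (index0 a) ≤ toℕ r
  index0-≤ r pos = ≮⇒≥ (λ r<i → <⇒≢ pos (sym (index0-minimal r r<i)))

¬IsInt-empty : ∀ {n} {a : Square 0} → ¬ IsInt (suc n) (mat 0 a)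
¬IsInt-empty H = 0≢1+n (IsInt.sumIs H)

module _ {n d} {a : Square d} (H : IsInt n (mat d a)) where
  open IsInt H

  positive⇒row≤col : ∀ {i j} → 0 < a i j → toℕ i ≤ toℕ j
  positive⇒row≤col {i} {j} pos = ≮⇒≥ (λ j<i → <⇒≢ pos (sym (upper i j j<i)))

  dim≤ : d ≤ n
  dim≤ = subst (d ≤_) sumIs (card≤∑ (λ i → ∑ (a i)) rowSum-pos)
    where
      rowSum-pos : ∀ i → 0 < ∑ (a i)
      rowSum-pos i = let (j , pos) = rowsNZ i in ≤-trans pos (term≤∑ j (a i))

Int1⇒dim≡1 : ∀ {d} {a : Square d} → IsInt 1 (mat d a) → d ≡ 1
Int1⇒dim≡1 {zero}  H = ⊥-elim (¬IsInt-empty H)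
Int1⇒dim≡1 {suc d} H = cong suc (n≤0⇒n≡0 (s≤s⁻¹ (dim≤ H)))

-- Deleting a row and the column of the same index

punchIn-fromℕ : ∀ {m} (i : Fin m) → punchIn (fromℕ m) i ≡ inject₁ i
punchIn-fromℕ {suc m} fzero    = refl
punchIn-fromℕ {suc m} (fsuc i) = cong fsuc (punchIn-fromℕ i)

toℕ≤toℕ-punchIn : ∀ {m} (i : Fin (suc m)) j → toℕ j ≤ toℕ (punchIn i j)
toℕ≤toℕ-punchIn fzero    j        = n≤1+n (toℕ j)
toℕ≤toℕ-punchIn (fsuc i) fzero    = z≤n
toℕ≤toℕ-punchIn (fsuc i) (fsuc j) = s≤s (toℕ≤toℕ-punchIn i j)

toℕ-punchIn≤suc : ∀ {m} (i : Fin (suc m)) j → toℕ (punchIn i j) ≤ suc (toℕ j)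
toℕ-punchIn≤suc fzero    j        = ≤-refl
toℕ-punchIn≤suc (fsuc i) fzero    = z≤n
toℕ-punchIn≤suc (fsuc i) (fsuc j) = s≤s (toℕ-punchIn≤suc i j)

minor : ∀ {m} → Fin (suc m) → Square (suc m) → Square m
minor p a i j = a (punchIn p i) (punchIn p j)

IsMinor : ∀ {m} → Fin (suc m) → Square (suc m) → Square m → Set
IsMinor p a b = ∀ i j → b i j ≡ minor p a i j

module _ {m} (p : Fin (suc m)) (a : Square (suc m)) {b : Square m} (b-minor : IsMinor p a b) where

  entrySum-minor : entrySum (mat (suc m) a) ≡ ∑ (a p) + ∑ (λ i → a (punchIn p i) p + ∑ (b i))
  entrySum-minor = trans (∑-removeAt p (λ i → ∑ (a i))) (cong (∑ (a p) +_) (∑-cong row))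
    where
      row : ∀ i → ∑ (a (punchIn p i)) ≡ a (punchIn p i) p + ∑ (b i)
      row i = trans (∑-removeAt p (a (punchIn p i))) (cong (a (punchIn p i) p +_) (sym (∑-cong (b-minor i))))

  trace-minor : trace (mat (suc m) a) ≡ a p p + trace (mat m b)
  trace-minor = trans (∑-removeAt p (λ i → a i i)) (cong (a p p +_) (sym (∑-cong (λ i → b-minor i i))))

  upper-minor : (∀ i j → toℕ j < toℕ i → a i j ≡ 0) → ∀ i j → toℕ j < toℕ i → b i j ≡ 0
  upper-minor upper i j j<i =
    trans (b-minor i j) (upper _ _ (≰⇒> (λ pi≤pj → <⇒≱ j<i (FinP.punchIn-cancel-≤ p i j pi≤pj))))

  rowsNZ-minor : (∀ i → i ≢ p → ∃[ j ] (j ≢ p × 0 < a i j)) → ∀ i → ∃[ j ] 0 < b i j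
  rowsNZ-minor rows i with rows (punchIn p i) (FinP.punchInᵢ≢i p i)
  ... | j , j≢p , pos =
    punchOut p≢j , subst (0 <_) (sym (trans (b-minor i _) (cong (a _) (FinP.punchIn-punchOut p≢j)))) pos
    where
      p≢j : p ≢ j
      p≢j = j≢p ∘ sym

  colsNZ-minor : (∀ j → j ≢ p → ∃[ i ] (i ≢ p × 0 < a i j)) → ∀ j → ∃[ i ] 0 < b i j
  colsNZ-minor cols j with cols (punchIn p j) (FinP.punchInᵢ≢i p j)
  ... | i , i≢p , pos =
    punchOut p≢i , subst (0 <_) (sym (trans (b-minor _ j) (cong (λ r → a r _) (FinP.punchIn-punchOut p≢i)))) pos
    where
      p≢i : p ≢ i
      p≢i = i≢p ∘ sym

-- The removal operation f

anyF-reflects : ∀ {d} (g : Fin d → Bool) → Reflects (∃[ i ] T (g i)) (anyF g)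
anyF-reflects {zero}  g = ofⁿ λ ()
anyF-reflects {suc d} g with g fzero in g0
... | true = ofʸ (fzero , subst T (sym g0) _)
... | false with anyF (g ∘ fsuc) | anyF-reflects (g ∘ fsuc)
...   | true  | ofʸ (i , gi) = ofʸ (fsuc i , gi)
...   | false | ofⁿ none     = ofⁿ λ { (fzero , g0′) → subst T g0 g0′ ; (fsuc i , gi) → none (i , gi) }

module Removal {m} (a : Square (suc m)) where

  last : Fin (suc m)
  last = fromℕ m

  idx : Fin (suc m)
  idx = index0 a

  ≡last⇒toℕ≡m : ∀ {i} → i ≡ last → toℕ i ≡ m
  ≡last⇒toℕ≡m refl = FinP.toℕ-fromℕ m

  toℕ≡m⇒≡last : ∀ {i} → toℕ i ≡ m → i ≡ last
  toℕ≡m⇒≡last eq = FinP.toℕ-injective (trans eq (sym (FinP.toℕ-fromℕ m)))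

  v : ℕ
  v = a idx last

  -- The results of Rem1, Rem2 and Rem3, written exactly as in the where-clauses of f, so that
  -- f (mat (suc m) a) computes to one of them once the conditions of f are decided.
  decrement : Square (suc m)
  decrement i j = if isYes (i FinP.≟ idx) ∧ isYes (j FinP.≟ last) then a i j ∸ 1 else a i j

  deleteLast : Square m
  deleteLast i j = a (inject₁ i) (inject₁ j)

  copied : Square (suc m)
  copied i j = if isYes (j FinP.≟ last) ∧ (toℕ i <ᵇ toℕ idx) then a i idx else a i j

  contract : Square m
  contract = minor idx copied

  decrement-offRow : ∀ {i} j → i ≢ idx → decrement i j ≡ a i j
  decrement-offRow {i} j i≢idx rewrite isYes-false (i FinP.≟ idx) i≢idx = refl

  decrement-offCol : ∀ i {j} → j ≢ last → decrement i j ≡ a i j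
  decrement-offCol i {j} j≢last rewrite isYes-false (j FinP.≟ last) j≢last with isYes (i FinP.≟ idx)
  ... | true  = refl
  ... | false = refl

  decrement-at : decrement idx last ≡ v ∸ 1
  decrement-at rewrite isYes-true (idx FinP.≟ idx) refl | isYes-true (last FinP.≟ last) refl = refl

  decrement-≤ : ∀ i j → decrement i j ≤ a i j
  decrement-≤ i j with isYes (i FinP.≟ idx) ∧ isYes (j FinP.≟ last)
  ... | true  = m∸n≤m (a i j) 1
  ... | false = ≤-refl

  copied-offLast : ∀ i {j} → j ≢ last → copied i j ≡ a i j
  copied-offLast i {j} j≢last rewrite isYes-false (j FinP.≟ last) j≢last = refl

  copied-above : ∀ {i} → toℕ i < toℕ idx → copied i last ≡ a i idx
  copied-above {i} i<idx rewrite isYes-true (last FinP.≟ last) refl | dec-true (toℕ i <? toℕ idx) i<idx = refl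

  copied-below : ∀ {i} → ¬ toℕ i < toℕ idx → copied i last ≡ a i last
  copied-below {i} i≮idx rewrite isYes-true (last FinP.≟ last) refl | dec-false (toℕ i <? toℕ idx) i≮idx = refl

  offLastPositive : Fin (suc m) → Bool
  offLastPositive j = not (isYes (j FinP.≟ last)) ∧ (1 ≤ᵇ a idx j)

  offLastPositive⇔ : ∀ j → T (offLastPositive j) ⇔ (j ≢ last × 0 < a idx j)
  offLastPositive⇔ j = mk⇔
    (λ t → let (t₁ , t₂) = Equivalence.to T-∧ t in toWitnessFalse t₁ , ≤ᵇ⇒≤ 1 (a idx j) t₂)
    (λ (j≢last , pos) → Equivalence.from T-∧ (fromWitnessFalse j≢last , ≤⇒≤ᵇ pos))

  Rem1-applies : Set
  Rem1-applies = 2 ≤ v ⊎ (idx ≢ last × ∃[ j ] (j ≢ last × 0 < a idx j))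

  data Case : Mat → Set where
    rem1 : Rem1-applies → Case (mat (suc m) decrement)
    rem2 : ¬ 2 ≤ v → idx ≡ last → Case (mat m deleteLast)
    rem3 : ¬ 2 ≤ v → idx ≢ last → (∀ j → j ≢ last → a idx j ≡ 0) → Case (mat m contract)

  case : Case (f (mat (suc m) a))
  case with 2 ≤ᵇ v | ≤ᵇ-reflects-≤ 2 v
  ... | true  | ofʸ big   = rem1 (inj₁ big)
  ... | false | ofⁿ small with toℕ idx ≡ᵇ m | proof (toℕ idx ≟ m)
  ...   | true  | ofʸ atLast  = rem2 small (toℕ≡m⇒≡last atLast)
  ...   | false | ofⁿ notLast with anyF offLastPositive | anyF-reflects offLastPositive
  ...     | true  | ofʸ (j , t) = rem1 (inj₂ (notLast ∘ ≡last⇒toℕ≡m , j , Equivalence.to (offLastPositive⇔ j) t))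
  ...     | false | ofⁿ none    = rem3 small (notLast ∘ ≡last⇒toℕ≡m) zero-off
    where
      zero-off : ∀ j → j ≢ last → a idx j ≡ 0
      zero-off j j≢last = n≤0⇒n≡0 (≮⇒≥ (λ pos → none (j , Equivalence.from (offLastPositive⇔ j) (j≢last , pos))))

-- The entry appended by Γ: Γ (suc (suc k)) A reduces to Γ (suc k) (f A) ∷ʳ indexOf A
-- as soon as A has the form mat (suc m) a.
indexOf : Mat → ℕ
indexOf (mat zero    a) = 0
indexOf (mat (suc m) a) = toℕ (index0 a)

record RemovalStep (n : ℕ) (A B : Mat) : Set where
  field
    isInt      : IsInt n B
    trace-step : trace A ≡ trace B + indicator (isYes (indexOf A ≟ dim A ∸ 1))
    asc-step   : dim B ∸ 1 + indicator (indexOf B <ᵇ indexOf A) ≡ dim A ∸ 1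

pred+indicator : ∀ {m k x} → x < k → k ≤ m → m ∸ 1 + indicator (x <ᵇ k) ≡ m
pred+indicator {zero}  ()  z≤n
pred+indicator {suc m} {k} {x} x<k k≤m = trans (cong (λ b → m + indicator b) (dec-true (x <? k) x<k)) (+-comm m 1)

index-below-dim : ∀ {m} (b : Square m) → m ∸ 1 + indicator (indexOf (mat m b) <ᵇ m) ≡ m
index-below-dim {zero}  b = refl
index-below-dim {suc m} b = pred+indicator (FinP.toℕ<n (index0 b)) ≤-refl

index-drop : ∀ {m k} (b : Square m) {r c : Fin m} →
             suc (toℕ c) ≡ m → 0 < b r c → toℕ r < k → indexOf (mat m b) < k
index-drop {suc m} b {r} {c} c-last pos r<k = ≤-<-trans (index0-≤ b r (subst (λ c → 0 < b r c) c≡last pos)) r<k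
  where
    c≡last : c ≡ fromℕ m
    c≡last = FinP.toℕ-injective (trans (suc-injective c-last) (sym (FinP.toℕ-fromℕ m)))

module Removable {n m} {a : Square (suc m)} (H : IsInt (suc n) (mat (suc m) a)) where
  open IsInt H
  open Removal a

  v-pos : 0 < v
  v-pos = let (r , pos) = colsNZ last in index0-positive a r pos

  v≡1 : ¬ 2 ≤ v → v ≡ 1
  v≡1 small = ≤-antisym (s≤s⁻¹ (≰⇒> small)) v-pos

  zero-above-idx : ∀ r → toℕ r < toℕ idx → a r last ≡ 0
  zero-above-idx = index0-minimal a

  ≢last⇒< : ∀ {i} → i ≢ last → toℕ i < toℕ last
  ≢last⇒< i≢last = ≤∧≢⇒< (FinP.≤fromℕ _) (i≢last ∘ FinP.toℕ-injective)

  last-row-zero : ∀ j → j ≢ last → a last j ≡ 0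
  last-row-zero j j≢last = upper last j (≢last⇒< j≢last)

  last-diag-pos : 0 < a last last
  last-diag-pos with rowsNZ last
  ... | j , pos with j FinP.≟ last
  ...   | yes refl    = pos
  ...   | no  j≢last = ⊥-elim (<⇒≢ pos (sym (last-row-zero j j≢last)))

  module Rem1 where

    v≡1+decrement : v ≡ 1 + decrement idx last
    v≡1+decrement = trans (sym (m+[n∸m]≡n v-pos)) (cong (1 +_) (sym decrement-at))

    decrement-at-pos : 2 ≤ v → 0 < decrement idx last
    decrement-at-pos big = s≤s⁻¹ (subst (2 ≤_) v≡1+decrement big)

    entrySum-decrement : entrySum (mat (suc m) a) ≡ 1 + entrySum (mat (suc m) decrement)
    entrySum-decrement =
      ∑-add-at idx {c = 1} (λ i i≢idx → ∑-cong (λ j → sym (decrement-offRow j i≢idx)))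
                   (∑-add-at last {c = 1} (λ j j≢last → sym (decrement-offCol idx j≢last)) v≡1+decrement)

    idx-row-positive : Rem1-applies → ∃[ j ] 0 < decrement idx j
    idx-row-positive (inj₁ big)                    = last , decrement-at-pos big
    idx-row-positive (inj₂ (_ , j , j≢last , pos)) = j , subst (0 <_) (sym (decrement-offCol idx j≢last)) pos

    last-col-positive : Rem1-applies → ∃[ i ] 0 < decrement i last
    last-col-positive (inj₁ big)            = idx , decrement-at-pos big
    last-col-positive (inj₂ (idx≢last , _)) =
      last , subst (0 <_) (sym (decrement-offRow last (idx≢last ∘ sym))) last-diag-pos

    rowsNZ-decrement : Rem1-applies → ∀ i → ∃[ j ] 0 < decrement i j
    rowsNZ-decrement cond i = row (i FinP.≟ idx)
      where
        row : Dec (i ≡ idx) → ∃[ j ] 0 < decrement i j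
        row (yes refl)   = idx-row-positive cond
        row (no i≢idx) = let (j , pos) = rowsNZ i in j , subst (0 <_) (sym (decrement-offRow j i≢idx)) pos

    colsNZ-decrement : Rem1-applies → ∀ j → ∃[ i ] 0 < decrement i j
    colsNZ-decrement cond j = col (j FinP.≟ last)
      where
        col : Dec (j ≡ last) → ∃[ i ] 0 < decrement i j
        col (yes refl)    = last-col-positive cond
        col (no j≢last) = let (i , pos) = colsNZ j in i , subst (0 <_) (sym (decrement-offCol i j≢last)) pos

    isInt-decrement : Rem1-applies → IsInt n (mat (suc m) decrement)
    isInt-decrement cond = record
      { upper  = λ i j j<i → n≤0⇒n≡0 (≤-trans (decrement-≤ i j) (≤-reflexive (upper i j j<i)))
      ; sumIs  = suc-injective (trans (sym entrySum-decrement) sumIs)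
      ; rowsNZ = rowsNZ-decrement cond
      ; colsNZ = colsNZ-decrement cond
      }

    decrement-diag : idx ≢ last → ∀ i → decrement i i ≡ a i i
    decrement-diag idx≢last i = diag (i FinP.≟ last)
      where
        diag : Dec (i ≡ last) → decrement i i ≡ a i i
        diag (yes refl)  = decrement-offRow last (idx≢last ∘ sym)
        diag (no i≢last) = decrement-offCol i i≢last

    trace-decrement : trace (mat (suc m) a) ≡ trace (mat (suc m) decrement) + indicator (isYes (toℕ idx ≟ m))
    trace-decrement with idx FinP.≟ last
    ... | yes idx≡last rewrite isYes-true (toℕ idx ≟ m) (≡last⇒toℕ≡m idx≡last) =
      trans (∑-add-at last (λ i i≢last → sym (decrement-offCol i i≢last)) diag) (+-comm 1 _)
      where
        diag : a last last ≡ 1 + decrement last last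
        diag = subst (λ i → a i last ≡ 1 + decrement i last) idx≡last v≡1+decrement
    ... | no idx≢last rewrite isYes-false (toℕ idx ≟ m) (idx≢last ∘ toℕ≡m⇒≡last) =
      trans (∑-cong (λ i → sym (decrement-diag idx≢last i))) (sym (+-identityʳ _))

    index-decrement-≮ : Rem1-applies → ¬ toℕ (index0 decrement) < toℕ idx
    index-decrement-≮ cond lt = <⇒≢ pos (sym (zero-above-idx _ lt))
      where
        pos : 0 < a (index0 decrement) last
        pos = subst (0 <_) (decrement-offRow last (λ eq → <-irrefl (cong toℕ eq) lt))
                (let (r , pos) = colsNZ-decrement cond last in index0-positive decrement r pos)

    step : Rem1-applies → RemovalStep n (mat (suc m) a) (mat (suc m) decrement)
    step cond = record
      { isInt      = isInt-decrement cond
      ; trace-step = trace-decrement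
      ; asc-step   = trans (cong (λ b → m + indicator b) (dec-false (_ <? _) (index-decrement-≮ cond))) (+-identityʳ m)
      }

  module Rem2 (small : ¬ 2 ≤ v) (idx≡last : idx ≡ last) where

    last-col-zero : ∀ r → r ≢ last → a r last ≡ 0
    last-col-zero r r≢last = zero-above-idx r (subst (λ i → toℕ r < toℕ i) (sym idx≡last) (≢last⇒< r≢last))

    last-diag≡1 : a last last ≡ 1
    last-diag≡1 = trans (cong (λ i → a i last) (sym idx≡last)) (v≡1 small)

    deleteLast-minor : IsMinor last a deleteLast
    deleteLast-minor i j = cong₂ a (sym (punchIn-fromℕ i)) (sym (punchIn-fromℕ j))

    entrySum-deleteLast : entrySum (mat (suc m) a) ≡ 1 + entrySum (mat m deleteLast)
    entrySum-deleteLast = trans (entrySum-minor last a deleteLast-minor) (cong₂ _+_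
      (trans (∑-single last (a last) last-row-zero) last-diag≡1)
      (∑-cong (λ i → cong (_+ ∑ (deleteLast i)) (last-col-zero _ (FinP.punchInᵢ≢i last i)))))

    rowsNZ-offLast : ∀ i → i ≢ last → ∃[ j ] (j ≢ last × 0 < a i j)
    rowsNZ-offLast i i≢last =
      let (j , pos) = rowsNZ i
      in j , (λ j≡last → <⇒≢ pos (sym (trans (cong (a i) j≡last) (last-col-zero i i≢last)))) , pos

    colsNZ-offLast : ∀ j → j ≢ last → ∃[ i ] (i ≢ last × 0 < a i j)
    colsNZ-offLast j j≢last =
      let (i , pos) = colsNZ j
      in i , (λ i≡last → <⇒≢ pos (sym (trans (cong (λ i → a i j) i≡last) (last-row-zero j j≢last)))) , pos

    isInt-deleteLast : IsInt n (mat m deleteLast)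
    isInt-deleteLast = record
      { upper  = upper-minor last a deleteLast-minor upper
      ; sumIs  = suc-injective (trans (sym entrySum-deleteLast) sumIs)
      ; rowsNZ = rowsNZ-minor last a deleteLast-minor rowsNZ-offLast
      ; colsNZ = colsNZ-minor last a deleteLast-minor colsNZ-offLast
      }

    trace-deleteLast : trace (mat (suc m) a) ≡ trace (mat m deleteLast) + indicator (isYes (toℕ idx ≟ m))
    trace-deleteLast rewrite isYes-true (toℕ idx ≟ m) (≡last⇒toℕ≡m idx≡last) =
      trans (trace-minor last a deleteLast-minor) (trans (cong (_+ trace (mat m deleteLast)) last-diag≡1) (+-comm 1 _))

    step : RemovalStep n (mat (suc m) a) (mat m deleteLast)
    step = record
      { isInt      = isInt-deleteLast
      ; trace-step = trace-deleteLast
      ; asc-step   = subst (λ k → m ∸ 1 + indicator (indexOf (mat m deleteLast) <ᵇ k) ≡ m)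
                           (sym (≡last⇒toℕ≡m idx≡last)) (index-below-dim deleteLast)
      }

  module Rem3 (small : ¬ 2 ≤ v) (idx≢last : idx ≢ last) (idx-row-zero : ∀ j → j ≢ last → a idx j ≡ 0) where

    idx-diag-zero : a idx idx ≡ 0
    idx-diag-zero = idx-row-zero idx idx≢last

    above-idx : ∀ {r} → r ≢ idx → 0 < a r idx → toℕ r < toℕ idx
    above-idx r≢idx pos = ≤∧≢⇒< (positive⇒row≤col H pos) (r≢idx ∘ FinP.toℕ-injective)

    idx-col-witness : ∃[ r ] (toℕ r < toℕ idx × 0 < a r idx)
    idx-col-witness =
      let (r , pos) = colsNZ idx
      in r , above-idx (λ r≡idx → <⇒≢ pos (sym (trans (cong (λ i → a i idx) r≡idx) idx-diag-zero))) pos , pos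

    -- Above row idx the last column of a is zero, below it column idx is zero.
    copied-last : ∀ {r} → r ≢ idx → copied r last ≡ a r idx + a r last
    copied-last {r} r≢idx with toℕ r <? toℕ idx
    ... | yes r<idx = trans (copied-above r<idx) (sym (trans (cong (a r idx +_) (zero-above-idx r r<idx)) (+-identityʳ _)))
    ... | no  r≮idx = trans (copied-below r≮idx) (sym (cong (_+ a r last) (upper r idx idx<r)))
      where
        idx<r : toℕ idx < toℕ r
        idx<r = ≤∧≢⇒< (≮⇒≥ r≮idx) (r≢idx ∘ FinP.toℕ-injective ∘ sym)

    copied-≥ : ∀ {r} j → r ≢ idx → a r j ≤ copied r j
    copied-≥ {r} j r≢idx = go (j FinP.≟ last)
      where
        go : Dec (j ≡ last) → a r j ≤ copied r j
        go (yes refl)    = subst (a r last ≤_) (sym (copied-last r≢idx)) (m≤n+m (a r last) (a r idx))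
        go (no j≢last) = ≤-reflexive (sym (copied-offLast r j≢last))

    copied-diag : ∀ r → copied r r ≡ a r r
    copied-diag r = go (r FinP.≟ last)
      where
        go : Dec (r ≡ last) → copied r r ≡ a r r
        go (yes refl)    = copied-below (λ last<idx → <⇒≱ last<idx (FinP.≤fromℕ idx))
        go (no r≢last) = copied-offLast r r≢last

    copied-upper : ∀ i j → toℕ j < toℕ i → copied i j ≡ 0
    copied-upper i j j<i = trans (copied-offLast i j≢last) (upper i j j<i)
      where
        j≢last : j ≢ last
        j≢last j≡last = <⇒≱ j<i (subst (λ j → toℕ i ≤ toℕ j) (sym j≡last) (FinP.≤fromℕ i))

    copied-rowsNZ : ∀ i → i ≢ idx → ∃[ j ] (j ≢ idx × 0 < copied i j)
    copied-rowsNZ i i≢idx = let (j , pos) = rowsNZ i in go j pos (j FinP.≟ idx)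
      where
        go : ∀ j → 0 < a i j → Dec (j ≡ idx) → ∃[ j ] (j ≢ idx × 0 < copied i j)
        go j pos (yes refl)   = last , idx≢last ∘ sym , subst (0 <_) (sym (copied-above (above-idx i≢idx pos))) pos
        go j pos (no j≢idx) = j , j≢idx , ≤-trans pos (copied-≥ j i≢idx)

    copied-colsNZ : ∀ j → j ≢ idx → ∃[ i ] (i ≢ idx × 0 < copied i j)
    copied-colsNZ j _ = go (j FinP.≟ last)
      where
        go : Dec (j ≡ last) → ∃[ i ] (i ≢ idx × 0 < copied i j)
        go (yes refl) =
          let (r , r<idx , pos) = idx-col-witness
          in r , (λ r≡idx → <-irrefl (cong toℕ r≡idx) r<idx) , subst (0 <_) (sym (copied-above r<idx)) pos
        go (no j≢last) =
          let (r , pos) = colsNZ j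
          in r , (λ r≡idx → <⇒≢ pos (sym (trans (cong (λ i → a i j) r≡idx) (idx-row-zero j j≢last))))
               , subst (0 <_) (sym (copied-offLast r j≢last)) pos

    last′ : Fin m
    last′ = punchOut idx≢last

    punchIn-last′ : punchIn idx last′ ≡ last
    punchIn-last′ = FinP.punchIn-punchOut idx≢last

    suc-last′ : suc (toℕ last′) ≡ m
    suc-last′ = ≤-antisym (FinP.toℕ<n last′)
      (subst (_≤ suc (toℕ last′)) (≡last⇒toℕ≡m punchIn-last′) (toℕ-punchIn≤suc idx last′))

    contract-rowSum : ∀ i → ∑ (contract i) ≡ a (punchIn idx i) idx + ∑ (minor idx a i)
    contract-rowSum i = ∑-add-at last′ {c = a r idx} off at
      where
        r : Fin (suc m)
        r = punchIn idx i
        off : ∀ j → j ≢ last′ → contract i j ≡ a r (punchIn idx j)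
        off j j≢last′ =
          copied-offLast r (λ eq → j≢last′ (FinP.punchIn-injective idx j last′ (trans eq (sym punchIn-last′))))
        at : contract i last′ ≡ a r idx + a r (punchIn idx last′)
        at = subst (λ c → copied r c ≡ a r idx + a r c) (sym punchIn-last′) (copied-last (FinP.punchInᵢ≢i idx i))

    entrySum-contract : entrySum (mat (suc m) a) ≡ 1 + entrySum (mat m contract)
    entrySum-contract = trans (entrySum-minor idx a {b = minor idx a} (λ _ _ → refl))
      (cong₂ _+_ (trans (∑-single last (a idx) idx-row-zero) (v≡1 small)) (sym (∑-cong contract-rowSum)))

    contract-minor : IsMinor idx copied contract
    contract-minor _ _ = refl

    isInt-contract : IsInt n (mat m contract)
    isInt-contract = record
      { upper  = upper-minor idx copied contract-minor copied-upper
      ; sumIs  = suc-injective (trans (sym entrySum-contract) sumIs)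
      ; rowsNZ = rowsNZ-minor idx copied contract-minor copied-rowsNZ
      ; colsNZ = colsNZ-minor idx copied contract-minor copied-colsNZ
      }

    trace-contract : trace (mat (suc m) a) ≡ trace (mat m contract) + indicator (isYes (toℕ idx ≟ m))
    trace-contract rewrite isYes-false (toℕ idx ≟ m) (idx≢last ∘ toℕ≡m⇒≡last) =
      trans (trace-minor idx a {b = minor idx a} (λ _ _ → refl))
        (trans (cong₂ _+_ idx-diag-zero (∑-cong (λ i → sym (copied-diag (punchIn idx i))))) (sym (+-identityʳ _)))

    index-contract< : indexOf (mat m contract) < toℕ idx
    index-contract< with idx-col-witness
    ... | r , r<idx , pos = index-drop contract suc-last′ pos′ r′<idx
      where
        idx≢r : idx ≢ r
        idx≢r idx≡r = <-irrefl (cong toℕ (sym idx≡r)) r<idx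
        r′ : Fin m
        r′ = punchOut idx≢r
        punchIn-r′ : punchIn idx r′ ≡ r
        punchIn-r′ = FinP.punchIn-punchOut idx≢r
        pos′ : 0 < contract r′ last′
        pos′ = subst₂ (λ r c → 0 < copied r c) (sym punchIn-r′) (sym punchIn-last′)
                 (subst (0 <_) (sym (copied-above r<idx)) pos)
        r′<idx : toℕ r′ < toℕ idx
        r′<idx = ≤-<-trans (subst (toℕ r′ ≤_) (cong toℕ punchIn-r′) (toℕ≤toℕ-punchIn idx r′)) r<idx

    step : RemovalStep n (mat (suc m) a) (mat m contract)
    step = record
      { isInt      = isInt-contract
      ; trace-step = trace-contract
      ; asc-step   = pred+indicator index-contract< (s≤s⁻¹ (FinP.toℕ<n idx))
      }

f-step : ∀ {n m} {a : Square (suc m)} → IsInt (suc n) (mat (suc m) a) →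
         RemovalStep n (mat (suc m) a) (f (mat (suc m) a))
f-step {n} {m} {a} H = step (Removal.case a)
  where
    open Removal a using (Case; rem1; rem2; rem3)
    open Removable H using (module Rem1; module Rem2; module Rem3)
    step : ∀ {B} → Case B → RemovalStep n (mat (suc m) a) B
    step (rem1 cond)                    = Rem1.step cond
    step (rem2 small idx≡last)          = Rem2.step small idx≡last
    step (rem3 small idx≢last row-zero) = Rem3.step small idx≢last row-zero

-- Γ and the theorem

last-Γ : ∀ k A → IsInt (suc k) A → Vec.last (Γ (suc k) A) ≡ indexOf A
last-Γ zero    (mat d a) H with Int1⇒dim≡1 H
... | refl = sym (n<1⇒n≡0 (FinP.toℕ<n (index0 a)))
last-Γ (suc k) (mat zero    a) _ = last-∷ʳ 0 (Γ (suc k) (f (mat zero a)))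
last-Γ (suc k) (mat (suc m) a) _ = last-∷ʳ (toℕ (index0 a)) (Γ (suc k) (f (mat (suc m) a)))

asc-Γ : ∀ k A → IsInt (suc k) A → asc (toList (Γ (suc k) A)) ≡ dim A ∸ 1
asc-Γ zero    (mat d a) H with Int1⇒dim≡1 H
... | refl = refl
asc-Γ (suc k) (mat zero    a) H = ⊥-elim (¬IsInt-empty H)
asc-Γ (suc k) A@(mat (suc m) a) H = begin
  asc (toList (xs ∷ʳ indexOf A))
    ≡⟨ asc-∷ʳ xs (indexOf A) ⟩
  asc (toList xs) + indicator (Vec.last xs <ᵇ indexOf A)
    ≡⟨ cong₂ (λ s l → s + indicator (l <ᵇ indexOf A)) (asc-Γ k B isInt) (last-Γ k B isInt) ⟩
  dim B ∸ 1 + indicator (indexOf B <ᵇ indexOf A)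
    ≡⟨ asc-step ⟩
  m ∎
  where
    B : Mat
    B = f A
    xs : Vec ℕ (suc k)
    xs = Γ (suc k) B
    open RemovalStep (f-step H)

trace-Γ : ∀ k A → IsInt (suc k) A → trace A ≡ fixedCount (Γ (suc k) A)
trace-Γ zero    (mat d a) H with Int1⇒dim≡1 H
... | refl = trans (sym (+-identityʳ _)) (IsInt.sumIs H)
trace-Γ (suc k) (mat zero    a) H = ⊥-elim (¬IsInt-empty H)
trace-Γ (suc k) A@(mat (suc m) a) H = begin
  trace A
    ≡⟨ trace-step ⟩
  trace B + indicator (isYes (indexOf A ≟ m))
    ≡⟨ cong₂ (λ t s → t + indicator (isYes (indexOf A ≟ s))) (trace-Γ k B isInt) (sym (asc-Γ (suc k) A H)) ⟩
  fixedCount xs + indicator (isYes (indexOf A ≟ asc (toList (xs ∷ʳ indexOf A))))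
    ≡⟨ fixedCount-∷ʳ xs (indexOf A) ⟨
  fixedCount (xs ∷ʳ indexOf A) ∎
  where
    B : Mat
    B = f A
    xs : Vec ℕ (suc k)
    xs = Γ (suc k) B
    open RemovalStep (f-step H)

mainTheorem8 : (n : ℕ) → 1 ≤ n → (A : Mat) → IsInt n A → trace A ≡ fixedCount (Γ n A)
mainTheorem8 (suc k) _ A H = trace-Γ k A H
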